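{- Let $M$ be a finite set of nonzero integers such that $\{ -1,1\}\subseteq M$ and $|M|$ is odd. Then $M$ does not split $\mathbb{Z}_p$ for any prime $p$. In particular, if $1\le k_1\le k_2$ are integers and $k_1+k_2$ is odd, then $[-k_1,k_2]^\ast$ does not split $\mathbb{Z}_p$ for any prime $p$.
   Context: $[a,b]^\ast=\{a,a+1,\ldots,b\}\setminus\{0\}$. For a finite group $G$ (written additively) and a set $M$ of integers, $M$ splits $G$ if there is $S\subseteq G$ such that every nonzero $g\in G$ has a unique representation $g=ms$ with $m\in M$, $s\in S$, while $0$ has no such representation (with $ms$ the $m$-fold sum of $s$ for $m\ge0$ and $-((-m)s)$ for $m<0$). -}

module Defs where

open import Data.Nat.Base as ℕ using (ℕ; NonZero)
open import Data.Integer.Base using (ℤ; +_; -[1+_]; _*_; _%ℕ_)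
open import Data.Integer.DivMod using (n%ℕd<d)
open import Data.Fin.Base using (Fin; toℕ; fromℕ<)
open import Data.Fin.Subset using (Subset) renaming (_∈_ to _∈ₛ_)
open import Data.List.Base using (List; map; upTo; _++_)
open import Data.List.Membership.Propositional using (_∈_)
open import Data.Product using (Σ; _×_; _,_)
open import Relation.Binary.PropositionalEquality using (_≡_; _≢_)

-- Z_p is represented by Fin p (residues 0..p-1).
-- The action m·s of an integer m on s ∈ Z_p (the m-fold sum of s, negated for m<0)
-- is the residue of m * s modulo p.
_·[_]_ : ℤ → (p : ℕ) → .{{NonZero p}} → Fin p → Fin p
(m ·[ p ] s) = fromℕ< (n%ℕd<d (m * + toℕ s) p)

Splits : List ℤ → (p : ℕ) → .{{NonZero p}} → Set
Splits M p = Σ (Subset p) λ S →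
  ((g : Fin p) → toℕ g ≢ 0 →
     Σ ℤ λ m → Σ (Fin p) λ s →
       (m ∈ M × s ∈ₛ S × (m ·[ p ] s) ≡ g) ×
       ((m′ : ℤ) (s′ : Fin p) → m′ ∈ M → s′ ∈ₛ S → (m′ ·[ p ] s′) ≡ g →
          (m′ ≡ m × s′ ≡ s)))
  × ((m : ℤ) (s : Fin p) → m ∈ M → s ∈ₛ S → toℕ (m ·[ p ] s) ≢ 0)

-- [-k₁,k₂]* = {-k₁,…,k₂} \ {0}, listed as -1,…,-k₁ followed by 1,…,k₂.
intervalStar : ℕ → ℕ → List ℤ
intervalStar k₁ k₂ = map (λ i → -[1+ i ]) (upTo k₁) ++ map (λ i → + ℕ.suc i) (upTo k₂)

-- Let S ⊆ ℤ_p witness that M splits ℤ_p, and for g ∈ ℤ_p let N g and P g count the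
-- pairs (m, s) ∈ M × S with m·s = g and with m²·s = g respectively.  Summed over g,
-- both counts give |M|·|S|.  Splitting says N g = 1 for g ≠ 0 and N 0 = 0.  As p is
-- prime, every a ∈ M is a unit mod p, so for g ≠ 0 the triples (a, b, s) with
-- (ab)·s = g number exactly |M|; the involution (a, b) ↦ (b, a) then gives
-- P g ≡ |M| ≡ 1 (mod 2), hence P ≥ N pointwise.  But for s ∈ S both m = 1 and
-- m = -1 contribute to P s, so P s ≥ 2 > N s, contradicting the equal totals.
module Submission where

open import Defs
import Data.Nat.Properties as ℕP
open import Algebra.Properties.CommutativeSemigroup ℕP.+-commutativeSemigroup using (interchange)
open import Data.Empty using (⊥; ⊥-elim)
open import Data.Fin.Base using (Fin; toℕ; fromℕ<)
open import Data.Fin.Properties using (toℕ-fromℕ<; toℕ-injective; toℕ<n; _≟_)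
open import Data.Fin.Subset using (Subset) renaming (_∈_ to _∈ₛ_)
open import Data.Fin.Subset.Properties using (_∈?_)
open import Data.Integer.Base using (ℤ; +_; -[1+_]; +[1+_]; _*_; _+_; -_; _%ℕ_; _/ℕ_)
open import Data.Integer.DivMod using (n%ℕd<d; a≡a%ℕn+[a/ℕn]*n)
import Data.Integer.Properties as ℤP
open import Data.Integer.Tactic.RingSolver using (solve-∀)
import Data.Nat.Tactic.RingSolver as NatSolver
open import Data.List.Base using (List; []; _∷_; length; map; upTo; _++_; allFin)
open import Data.List.Membership.Propositional using (_∈_)
open import Data.List.Membership.Propositional.Properties using (∈-allFin; ∈-map⁻; ∈-++⁺ˡ; ∈-++⁺ʳ)
open import Data.List.Properties using (length-++; length-map; length-upTo)
open import Data.List.Relation.Unary.All as All using (All)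
open import Data.List.Relation.Unary.AllPairs using (_∷_)
open import Data.List.Relation.Unary.Any using (here; there)
open import Data.List.Relation.Unary.Unique.Propositional using (Unique)
open import Data.List.Relation.Unary.Unique.Propositional.Properties as Unique using (allFin⁺)
open import Data.Nat.Base as ℕ using (ℕ; zero; suc; _≤_; _<_; z≤n; s≤s; NonZero)
open import Data.Nat.Coprimality using (prime⇒coprime; coprime-Bézout)
open import Data.Nat.DivMod using (m<n⇒m%n≡m; [m+kn]%n≡m%n)
open import Data.Nat.GCD using (module Bézout)
open import Data.Nat.Primality using (Prime; prime⇒nonZero; prime⇒nonTrivial)
open import Data.Product using (∃-syntax; _×_; _,_; proj₁; proj₂)
open import Function using (_∘_; id; _⇔_; mk⇔; Equivalence)
open import Level using (Level)
open import Relation.Binary.PropositionalEquality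
open import Relation.Nullary using (¬_; Dec; yes; no)
open import Relation.Nullary.Decidable using (_×-dec_)

private
  variable
    a : Level
    A B : Set a
    n p : ℕ

χ : Dec A → ℕ
χ (yes _) = 1
χ (no _)  = 0

χ-yes : (A? : Dec A) → A → χ A? ≡ 1
χ-yes (yes _) _ = refl
χ-yes (no ¬x) x = ⊥-elim (¬x x)

χ-no : (A? : Dec A) → ¬ A → χ A? ≡ 0
χ-no (yes x) ¬x = ⊥-elim (¬x x)
χ-no (no _)  _  = refl

χ-cong : (A? : Dec A) (B? : Dec B) → A ⇔ B → χ A? ≡ χ B?
χ-cong (yes _) (yes _) _   = refl
χ-cong (no _)  (no _)  _   = refl
χ-cong (yes x) (no ¬y) A⇔B = ⊥-elim (¬y (Equivalence.to A⇔B x))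
χ-cong (no ¬x) (yes y) A⇔B = ⊥-elim (¬x (Equivalence.from A⇔B y))

∑ : List A → (A → ℕ) → ℕ
∑ []       f = 0
∑ (x ∷ xs) f = f x ℕ.+ ∑ xs f

infix 5 ∑
syntax ∑ xs (λ x → e) = ∑[ x ∈ xs ] e

∑-cong : {f g : A → ℕ} (xs : List A) → (∀ {x} → x ∈ xs → f x ≡ g x) → ∑ xs f ≡ ∑ xs g
∑-cong []       _  = refl
∑-cong (x ∷ xs) eq = cong₂ ℕ._+_ (eq (here refl)) (∑-cong xs (eq ∘ there))

∑-zero : {f : A → ℕ} (xs : List A) → (∀ {x} → x ∈ xs → f x ≡ 0) → ∑ xs f ≡ 0
∑-zero []       _  = refl
∑-zero (x ∷ xs) eq = cong₂ ℕ._+_ (eq (here refl)) (∑-zero xs (eq ∘ there))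

∑-const-1 : (xs : List A) → ∑[ _ ∈ xs ] 1 ≡ length xs
∑-const-1 []       = refl
∑-const-1 (x ∷ xs) = cong suc (∑-const-1 xs)

∑-distrib-+ : (xs : List A) (f g : A → ℕ) → ∑[ x ∈ xs ] (f x ℕ.+ g x) ≡ ∑ xs f ℕ.+ ∑ xs g
∑-distrib-+ []       f g = refl
∑-distrib-+ (x ∷ xs) f g = trans (cong (f x ℕ.+ g x ℕ.+_) (∑-distrib-+ xs f g))
                                 (interchange (f x) (g x) (∑ xs f) (∑ xs g))

∑-comm : (xs : List A) (ys : List B) (f : A → B → ℕ) →
         ∑[ x ∈ xs ] ∑[ y ∈ ys ] f x y ≡ ∑[ y ∈ ys ] ∑[ x ∈ xs ] f x y
∑-comm []       ys f = sym (∑-zero ys (λ _ → refl))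
∑-comm (x ∷ xs) ys f = trans (cong (∑ ys (f x) ℕ.+_) (∑-comm xs ys f))
                             (sym (∑-distrib-+ ys (f x) (λ y → ∑[ x ∈ xs ] f x y)))

∑-mono-≤ : {f g : A → ℕ} (xs : List A) → (∀ x → f x ≤ g x) → ∑ xs f ≤ ∑ xs g
∑-mono-≤ []       _  = z≤n
∑-mono-≤ (x ∷ xs) le = ℕP.+-mono-≤ (le x) (∑-mono-≤ xs le)

∑-mono-< : {f g : A → ℕ} {xs : List A} {x : A} →
           (∀ y → f y ≤ g y) → x ∈ xs → f x < g x → ∑ xs f < ∑ xs g
∑-mono-< {xs = _ ∷ xs} le (here refl) lt = ℕP.+-mono-<-≤ lt (∑-mono-≤ xs le)
∑-mono-< {xs = y ∷ _}  le (there x∈)  lt = ℕP.+-mono-≤-< (le y) (∑-mono-< le x∈ lt)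

term≤∑ : (f : A → ℕ) {xs : List A} {x : A} → x ∈ xs → f x ≤ ∑ xs f
term≤∑ f {_ ∷ xs} (here refl) = ℕP.m≤m+n _ (∑ xs f)
term≤∑ f {y ∷ _}  (there x∈)  = ℕP.≤-trans (term≤∑ f x∈) (ℕP.m≤n+m _ (f y))

two-terms≤∑ : (f : A → ℕ) {xs : List A} {x y : A} → x ∈ xs → y ∈ xs → x ≢ y →
              f x ℕ.+ f y ≤ ∑ xs f
two-terms≤∑ f (here refl) (here refl) x≢y = ⊥-elim (x≢y refl)
two-terms≤∑ f (here refl) (there y∈)  _   = ℕP.+-monoʳ-≤ (f _) (term≤∑ f y∈)
two-terms≤∑ f {z ∷ xs} {x} (there x∈) (here refl) _ =
  subst (_≤ f z ℕ.+ ∑ xs f) (ℕP.+-comm (f z) (f x)) (ℕP.+-monoʳ-≤ (f z) (term≤∑ f x∈))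
two-terms≤∑ f {z ∷ _} (there x∈) (there y∈) x≢y =
  ℕP.≤-trans (two-terms≤∑ f x∈ y∈ x≢y) (ℕP.m≤n+m _ (f z))

∑-single : {f : A → ℕ} {xs : List A} {x : A} → Unique xs → x ∈ xs →
           (∀ {y} → y ∈ xs → y ≢ x → f y ≡ 0) → ∑ xs f ≡ f x
∑-single {xs = _ ∷ xs} (x∉xs ∷ _) (here refl) others = trans
  (cong (_ ℕ.+_) (∑-zero xs (λ y∈ → others (there y∈) (λ { refl → All.lookup x∉xs y∈ refl }))))
  (ℕP.+-identityʳ _)
∑-single {f = f} {xs = _ ∷ xs} (z∉xs ∷ xs-unique) (there x∈) others =
  trans (cong (ℕ._+ ∑ xs f) (others (here refl) (λ { refl → All.lookup z∉xs x∈ refl })))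
        (∑-single xs-unique x∈ (others ∘ there))

∑∑-sym≡∑-diagonal+even : (xs : List A) (F : A → A → ℕ) → (∀ x y → F x y ≡ F y x) →
  ∃[ k ] ∑[ x ∈ xs ] ∑[ y ∈ xs ] F x y ≡ (∑[ x ∈ xs ] F x x) ℕ.+ k ℕ.* 2
∑∑-sym≡∑-diagonal+even []       F F-sym = 0 , refl
∑∑-sym≡∑-diagonal+even (z ∷ xs) F F-sym with ∑∑-sym≡∑-diagonal+even xs F F-sym
... | k , eq = k ℕ.+ row , (begin
  F z z ℕ.+ row ℕ.+ (∑[ x ∈ xs ] (F x z ℕ.+ ∑ xs (F x)))
    ≡⟨ cong (F z z ℕ.+ row ℕ.+_) (∑-distrib-+ xs (λ x → F x z) (λ x → ∑ xs (F x))) ⟩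
  F z z ℕ.+ row ℕ.+ ((∑[ x ∈ xs ] F x z) ℕ.+ (∑[ x ∈ xs ] ∑ xs (F x)))
    ≡⟨ cong₂ (λ c r → F z z ℕ.+ row ℕ.+ (c ℕ.+ r)) (∑-cong xs (λ {x} _ → F-sym x z)) eq ⟩
  F z z ℕ.+ row ℕ.+ (row ℕ.+ (diagonal ℕ.+ k ℕ.* 2))
    ≡⟨ rearrange (F z z) row diagonal k ⟩
  F z z ℕ.+ diagonal ℕ.+ (k ℕ.+ row) ℕ.* 2 ∎)
  where
  open ≡-Reasoning
  row diagonal : ℕ
  row = ∑ xs (F z)
  diagonal = ∑[ x ∈ xs ] F x x
  rearrange : ∀ a b d k → a ℕ.+ b ℕ.+ (b ℕ.+ (d ℕ.+ k ℕ.* 2)) ≡ a ℕ.+ d ℕ.+ (k ℕ.+ b) ℕ.* 2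
  rearrange = NatSolver.solve-∀

infix 4 _≡_mod_
data _≡_mod_ (x y : ℤ) (n : ℕ) : Set where
  congruent : ∀ q → x ≡ y + q * + n → x ≡ y mod n

≡-+-*-flip : ∀ {x y q : ℤ} {n} → x ≡ y + q * + n → y ≡ x + (- q) * + n
≡-+-*-flip {y = y} {q} {n} refl = flip y q (+ n)
  where
  flip : ∀ y q n → y ≡ y + q * n + (- q) * n
  flip = solve-∀

mod-sym : ∀ {x y} → x ≡ y mod n → y ≡ x mod n
mod-sym (congruent q eq) = congruent (- q) (≡-+-*-flip {q = q} eq)

mod-trans : ∀ {x y z} → x ≡ y mod n → y ≡ z mod n → x ≡ z mod n
mod-trans {n = n} {z = z} (congruent q refl) (congruent r refl) = congruent (r + q) (regroup z q r (+ n))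
  where
  regroup : ∀ z q r n → z + r * n + q * n ≡ z + (r + q) * n
  regroup = solve-∀

*-congˡ-mod : ∀ m {x y} → x ≡ y mod n → m * x ≡ m * y mod n
*-congˡ-mod {n = n} m {y = y} (congruent q refl) = congruent (m * q) (distrib m y q (+ n))
  where
  distrib : ∀ m y q n → m * (y + q * n) ≡ m * y + m * q * n
  distrib = solve-∀

*-congʳ-mod : ∀ m {x y} → x ≡ y mod n → x * m ≡ y * m mod n
*-congʳ-mod {n = n} m {y = y} (congruent q refl) = congruent (q * m) (distrib m y q (+ n))
  where
  distrib : ∀ m y q n → (y + q * n) * m ≡ y * m + q * m * n
  distrib = solve-∀

module _ {{_ : NonZero n}} where

  x≡x%ℕn : ∀ x → x ≡ + (x %ℕ n) mod n
  x≡x%ℕn x = congruent (x /ℕ n) (a≡a%ℕn+[a/ℕn]*n x n)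

  positive-multiple-too-big : ∀ {r r′ k} → r < n → + r ≡ + r′ + +[1+ k ] * + n → ⊥
  positive-multiple-too-big {r} {r′} {k} r<n eq = ℕP.<⇒≱ r<n (begin
    n                     ≤⟨ ℕP.m≤m+n n (k ℕ.* n) ⟩
    suc k ℕ.* n           ≤⟨ ℕP.m≤n+m _ r′ ⟩
    r′ ℕ.+ suc k ℕ.* n    ≡⟨ ℤP.+-injective r≡r′+[1+k]n ⟨
    r                     ∎)
    where
    open ℕP.≤-Reasoning
    r≡r′+[1+k]n : + r ≡ + (r′ ℕ.+ suc k ℕ.* n)
    r≡r′+[1+k]n = trans eq (trans (cong (_+_ (+ r′)) (sym (ℤP.pos-* (suc k) n))) (sym (ℤP.pos-+ r′ _)))

  residue-unique : ∀ {r r′} → r < n → r′ < n → + r ≡ + r′ mod n → r ≡ r′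
  residue-unique r<n r′<n (congruent (+ zero) eq) = ℤP.+-injective (trans eq (ℤP.+-identityʳ _))
  residue-unique {r′ = r′} r<n r′<n (congruent +[1+ k ] eq) =
    ⊥-elim (positive-multiple-too-big {r′ = r′} {k} r<n eq)
  residue-unique r<n r′<n (congruent -[1+ k ] eq) =
    ⊥-elim (positive-multiple-too-big {k = k} r′<n (≡-+-*-flip {q = -[1+ k ]} {n} eq))

  mod⇒%ℕ≡ : ∀ {x y} → x ≡ y mod n → x %ℕ n ≡ y %ℕ n
  mod⇒%ℕ≡ {x} {y} x≡y = residue-unique (n%ℕd<d x n) (n%ℕd<d y n)
    (mod-trans (mod-sym (x≡x%ℕn x)) (mod-trans x≡y (x≡x%ℕn y)))

module _ {{_ : NonZero p}} where

  prime⇒invertible : Prime p → ∀ {m} → m %ℕ p ≢ 0 → ∃[ β ] β * m ≡ + 1 mod p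
  prime⇒invertible pr {m} m%p≢0 =
    let β , βr≡1 = bézout-inverse (coprime-Bézout (prime⇒coprime pr {{ℕ.≢-nonZero m%p≢0}} (n%ℕd<d m p)))
    in  β , mod-trans (*-congˡ-mod β (x≡x%ℕn m)) βr≡1
    where
    lift : ∀ a b c d → 1 ℕ.+ a ℕ.* b ≡ c ℕ.* d → + 1 + + a * + b ≡ + c * + d
    lift a b c d eq = begin
      + 1 + + a * + b      ≡⟨ cong (_+_ (+ 1)) (ℤP.pos-* a b) ⟨
      + (1 ℕ.+ a ℕ.* b)    ≡⟨ cong +_ eq ⟩
      + (c ℕ.* d)          ≡⟨ ℤP.pos-* c d ⟩
      + c * + d            ∎
      where open ≡-Reasoning
    bézout-inverse : ∀ {r} → Bézout.Identity 1 p r → ∃[ β ] β * + r ≡ + 1 mod p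
    bézout-inverse {r} (Bézout.+- x y eq) = - + y , congruent (- + x) (begin
      (- + y) * + r              ≡⟨ negate (+ y) (+ r) ⟩
      + 1 + - (+ 1 + + y * + r)  ≡⟨ cong (λ t → + 1 + - t) (lift y r x p eq) ⟩
      + 1 + - (+ x * + p)        ≡⟨ cong (_+_ (+ 1)) (ℤP.neg-distribˡ-* (+ x) (+ p)) ⟩
      + 1 + (- + x) * + p        ∎)
      where
      open ≡-Reasoning
      negate : ∀ y r → (- y) * r ≡ + 1 + - (+ 1 + y * r)
      negate = solve-∀
    bézout-inverse {r} (Bézout.-+ x y eq) = + y , congruent (+ x) (sym (lift x p y r eq))

  toℕ-· : ∀ m s → toℕ (m ·[ p ] s) ≡ (m * + toℕ s) %ℕ p
  toℕ-· m s = toℕ-fromℕ< (n%ℕd<d (m * + toℕ s) p)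

  0%p≡0 : 0 ℕ.% p ≡ 0
  0%p≡0 = m<n⇒m%n≡m (ℕ.>-nonZero⁻¹ p)

  ·-congˡ : ∀ {m m′} s → m ≡ m′ mod p → m ·[ p ] s ≡ m′ ·[ p ] s
  ·-congˡ {m} {m′} s m≡m′ = toℕ-injective (begin
    toℕ (m ·[ p ] s)       ≡⟨ toℕ-· m s ⟩
    (m * + toℕ s) %ℕ p     ≡⟨ mod⇒%ℕ≡ (*-congʳ-mod (+ toℕ s) m≡m′) ⟩
    (m′ * + toℕ s) %ℕ p    ≡⟨ toℕ-· m′ s ⟨
    toℕ (m′ ·[ p ] s)      ∎)
    where open ≡-Reasoning

  ·-assoc : ∀ m m′ s → m ·[ p ] (m′ ·[ p ] s) ≡ (m * m′) ·[ p ] s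
  ·-assoc m m′ s = toℕ-injective (begin
    toℕ (m ·[ p ] (m′ ·[ p ] s))           ≡⟨ toℕ-· m (m′ ·[ p ] s) ⟩
    (m * + toℕ (m′ ·[ p ] s)) %ℕ p         ≡⟨ cong (λ t → (m * + t) %ℕ p) (toℕ-· m′ s) ⟩
    (m * + ((m′ * + toℕ s) %ℕ p)) %ℕ p     ≡⟨ mod⇒%ℕ≡ (*-congˡ-mod m (mod-sym (x≡x%ℕn (m′ * + toℕ s)))) ⟩
    (m * (m′ * + toℕ s)) %ℕ p              ≡⟨ cong (_%ℕ p) (ℤP.*-assoc m m′ (+ toℕ s)) ⟨
    (m * m′ * + toℕ s) %ℕ p                ≡⟨ toℕ-· (m * m′) s ⟨
    toℕ ((m * m′) ·[ p ] s)                ∎)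
    where open ≡-Reasoning

  ·-identityˡ : ∀ s → (+ 1) ·[ p ] s ≡ s
  ·-identityˡ s = toℕ-injective (begin
    toℕ ((+ 1) ·[ p ] s)     ≡⟨ toℕ-· (+ 1) s ⟩
    (+ 1 * + toℕ s) %ℕ p     ≡⟨ cong (_%ℕ p) (ℤP.*-identityˡ (+ toℕ s)) ⟩
    toℕ s ℕ.% p              ≡⟨ m<n⇒m%n≡m (toℕ<n s) ⟩
    toℕ s                    ∎)
    where open ≡-Reasoning

  ·-zeroˡ : ∀ {m} s → m %ℕ p ≡ 0 → toℕ (m ·[ p ] s) ≡ 0
  ·-zeroˡ {m} s m%p≡0 = begin
    toℕ (m ·[ p ] s)       ≡⟨ toℕ-· m s ⟩
    (m * + toℕ s) %ℕ p     ≡⟨ mod⇒%ℕ≡ (*-congʳ-mod (+ toℕ s) m≡0) ⟩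
    0 ℕ.% p                ≡⟨ 0%p≡0 ⟩
    0                      ∎
    where
    open ≡-Reasoning
    m≡0 : m ≡ + 0 mod p
    m≡0 = subst (λ r → m ≡ + r mod p) m%p≡0 (x≡x%ℕn m)

  ·-zeroʳ : ∀ m {s} → toℕ s ≡ 0 → toℕ (m ·[ p ] s) ≡ 0
  ·-zeroʳ m {s} s≡0 = begin
    toℕ (m ·[ p ] s)       ≡⟨ toℕ-· m s ⟩
    (m * + toℕ s) %ℕ p     ≡⟨ cong (λ t → (m * + t) %ℕ p) s≡0 ⟩
    (m * + 0) %ℕ p         ≡⟨ cong (_%ℕ p) (ℤP.*-zeroʳ m) ⟩
    0 ℕ.% p                ≡⟨ 0%p≡0 ⟩
    0                      ∎
    where open ≡-Reasoning

  a·x≡g⇔x≡β·g : ∀ {a β} → β * a ≡ + 1 mod p → ∀ {x g} → a ·[ p ] x ≡ g ⇔ x ≡ β ·[ p ] g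
  a·x≡g⇔x≡β·g {a = a} {β = β} βa≡1 {x} {g} = mk⇔ solve check
    where
    open ≡-Reasoning
    solve : a ·[ p ] x ≡ g → x ≡ β ·[ p ] g
    solve ax≡g = begin
      x                         ≡⟨ ·-identityˡ x ⟨
      (+ 1) ·[ p ] x            ≡⟨ ·-congˡ x βa≡1 ⟨
      (β * a) ·[ p ] x          ≡⟨ ·-assoc β a x ⟨
      β ·[ p ] (a ·[ p ] x)     ≡⟨ cong (β ·[ p ]_) ax≡g ⟩
      β ·[ p ] g                ∎
    check : x ≡ β ·[ p ] g → a ·[ p ] x ≡ g
    check refl = begin
      a ·[ p ] (β ·[ p ] g)     ≡⟨ ·-assoc a β g ⟩
      (a * β) ·[ p ] g          ≡⟨ ·-congˡ g (subst (_≡ + 1 mod p) (ℤP.*-comm β a) βa≡1) ⟩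
      (+ 1) ·[ p ] g            ≡⟨ ·-identityˡ g ⟩
      g                         ∎

square : ℤ → ℤ
square m = m * m

module Representations {p : ℕ} {{_ : NonZero p}} (M : List ℤ) (S : Subset p) where

  hits : ℤ → Fin p → Fin p → ℕ
  hits c s g = χ (s ∈? S ×-dec c ·[ p ] s ≟ g)

  #reps : (ℤ → ℤ) → Fin p → ℕ
  #reps f g = ∑[ m ∈ M ] ∑[ s ∈ allFin p ] hits (f m) s g

  ∑-hits : ∀ c s → ∑[ g ∈ allFin p ] hits c s g ≡ χ (s ∈? S)
  ∑-hits c s with s ∈? S
  ... | yes s∈S = trans
    (∑-single (allFin⁺ p) (∈-allFin (c ·[ p ] s)) λ _ g≢cs → χ-no _ λ { (_ , cs≡g) → g≢cs (sym cs≡g) })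
    (χ-yes _ (s∈S , refl))
  ... | no _ = ∑-zero (allFin p) (λ _ → refl)

  ∑-#reps : ∀ f → ∑[ g ∈ allFin p ] #reps f g ≡ ∑[ m ∈ M ] ∑[ s ∈ allFin p ] χ (s ∈? S)
  ∑-#reps f = begin
    ∑[ g ∈ allFin p ] ∑[ m ∈ M ] ∑[ s ∈ allFin p ] hits (f m) s g
      ≡⟨ ∑-comm (allFin p) M (λ g m → ∑[ s ∈ allFin p ] hits (f m) s g) ⟩
    ∑[ m ∈ M ] ∑[ g ∈ allFin p ] ∑[ s ∈ allFin p ] hits (f m) s g
      ≡⟨ ∑-cong M (λ {m} _ → ∑-comm (allFin p) (allFin p) (λ g s → hits (f m) s g)) ⟩
    ∑[ m ∈ M ] ∑[ s ∈ allFin p ] ∑[ g ∈ allFin p ] hits (f m) s g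
      ≡⟨ ∑-cong M (λ {m} _ → ∑-cong (allFin p) (λ {s} _ → ∑-hits (f m) s)) ⟩
    ∑[ m ∈ M ] ∑[ s ∈ allFin p ] χ (s ∈? S) ∎
    where open ≡-Reasoning

module Splitting {p : ℕ} {{_ : NonZero p}} {M : List ℤ} (M-unique : Unique M) (split : Splits M p) where

  S : Subset p
  S = proj₁ split

  open Representations M S public

  ·-nonzero : ∀ {m s} → m ∈ M → s ∈ₛ S → toℕ (m ·[ p ] s) ≢ 0
  ·-nonzero = proj₂ (proj₂ split) _ _

  S-inhabited : Prime p → ∃[ s ] s ∈ₛ S
  S-inhabited pr = let _ , s , (_ , s∈S , _) , _ = proj₁ (proj₂ split) (fromℕ< 1<p) 1≢0 in s , s∈S
    where
    1<p : 1 < p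
    1<p = ℕ.nonTrivial⇒n>1 p {{prime⇒nonTrivial pr}}
    1≢0 : toℕ (fromℕ< 1<p) ≢ 0
    1≢0 = ℕP.1+n≢0 ∘ trans (sym (toℕ-fromℕ< 1<p))

  M-invertible : Prime p → ∀ {a s} → a ∈ M → s ∈ₛ S → ∃[ β ] β * a ≡ + 1 mod p
  M-invertible pr {a} {s} a∈M s∈S = prime⇒invertible pr {m = a} (·-nonzero a∈M s∈S ∘ ·-zeroˡ {m = a} s)

  #reps-id-zero : ∀ {g} → toℕ g ≡ 0 → #reps id g ≡ 0
  #reps-id-zero g≡0 = ∑-zero M λ m∈M → ∑-zero (allFin p) λ _ →
    χ-no _ λ { (s∈S , ms≡g) → ·-nonzero m∈M s∈S (trans (cong toℕ ms≡g) g≡0) }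

  #reps-id-nonzero : ∀ {g} → toℕ g ≢ 0 → #reps id g ≡ 1
  #reps-id-nonzero {g} g≢0 with proj₁ (proj₂ split) g g≢0
  ... | m , s , (m∈M , s∈S , ms≡g) , unique = begin
    ∑[ m′ ∈ M ] ∑[ s′ ∈ allFin p ] hits m′ s′ g
      ≡⟨ ∑-single M-unique m∈M (λ {m′} m′∈M m′≢m → ∑-zero (allFin p) λ {s′} _ →
           χ-no _ λ { (s′∈S , m′s′≡g) → m′≢m (proj₁ (unique m′ s′ m′∈M s′∈S m′s′≡g)) }) ⟩
    ∑[ s′ ∈ allFin p ] hits m s′ g
      ≡⟨ ∑-single (allFin⁺ p) (∈-allFin s) (λ {s′} _ s′≢s →
           χ-no _ λ { (s′∈S , ms′≡g) → s′≢s (proj₂ (unique m s′ m∈M s′∈S ms′≡g)) }) ⟩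
    hits m s g
      ≡⟨ χ-yes _ (s∈S , ms≡g) ⟩
    1 ∎
    where open ≡-Reasoning

  #reps-scaled : Prime p → ∀ {a g} → a ∈ M → toℕ g ≢ 0 → #reps (a *_) g ≡ 1
  #reps-scaled pr {a} {g} a∈M g≢0 with M-invertible pr a∈M (proj₂ (S-inhabited pr))
  ... | β , βa≡1 =
    trans (∑-cong M λ {b} _ → ∑-cong (allFin p) λ {s} _ → χ-cong _ _ (rescale b s)) (#reps-id-nonzero h≢0)
    where
    solve : ∀ {x} → a ·[ p ] x ≡ g ⇔ x ≡ β ·[ p ] g
    solve = a·x≡g⇔x≡β·g {a = a} {β = β} βa≡1
    h : Fin p
    h = β ·[ p ] g
    h≢0 : toℕ h ≢ 0
    h≢0 h≡0 = g≢0 (trans (cong toℕ (sym (Equivalence.from solve refl))) (·-zeroʳ a h≡0))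
    rescale : ∀ b s → (s ∈ₛ S × (a * b) ·[ p ] s ≡ g) ⇔ (s ∈ₛ S × b ·[ p ] s ≡ h)
    rescale b s = mk⇔
      (λ { (s∈S , e) → s∈S , Equivalence.to solve (trans (·-assoc a b s) e) })
      (λ { (s∈S , e) → s∈S , trans (sym (·-assoc a b s)) (Equivalence.from solve e) })

  #reps-square-odd : Prime p → length M ℕ.% 2 ≡ 1 → ∀ {g} → toℕ g ≢ 0 →
                     #reps square g ℕ.% 2 ≡ 1
  #reps-square-odd pr |M|-odd {g} g≢0 =
    let k , ∑∑≡ = ∑∑-sym≡∑-diagonal+even M F F-sym
    in  begin
    #reps square g ℕ.% 2                 ≡⟨ [m+kn]%n≡m%n (#reps square g) k 2 ⟨
    (#reps square g ℕ.+ k ℕ.* 2) ℕ.% 2   ≡⟨ cong (ℕ._% 2) ∑∑≡ ⟨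
    (∑[ a ∈ M ] ∑[ b ∈ M ] F a b) ℕ.% 2         ≡⟨ cong (ℕ._% 2) (∑-cong M λ a∈M → #reps-scaled pr a∈M g≢0) ⟩
    (∑[ _ ∈ M ] 1) ℕ.% 2                        ≡⟨ cong (ℕ._% 2) (∑-const-1 M) ⟩
    length M ℕ.% 2                              ≡⟨ |M|-odd ⟩
    1                                           ∎
    where
    open ≡-Reasoning
    F : ℤ → ℤ → ℕ
    F a b = ∑[ s ∈ allFin p ] hits (a * b) s g
    F-sym : ∀ a b → F a b ≡ F b a
    F-sym a b = cong (λ c → ∑[ s ∈ allFin p ] hits c s g) (ℤP.*-comm a b)

  ∈S⇒nonzero : + 1 ∈ M → ∀ {s} → s ∈ₛ S → toℕ s ≢ 0
  ∈S⇒nonzero 1∈M {s} s∈S s≡0 = ·-nonzero 1∈M s∈S (trans (cong toℕ (·-identityˡ s)) s≡0)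

  #reps-square-≥2 : + 1 ∈ M → - + 1 ∈ M → ∀ {s} → s ∈ₛ S → 2 ≤ #reps square s
  #reps-square-≥2 1∈M -1∈M {s} s∈S =
    ℕP.≤-trans (ℕP.+-mono-≤ hit-self hit-self)
               (two-terms≤∑ (λ m → ∑[ s′ ∈ allFin p ] hits (square m) s′ s) 1∈M -1∈M λ ())
    where
    hit-self : 1 ≤ ∑[ s′ ∈ allFin p ] hits (+ 1) s′ s
    hit-self = ℕP.≤-trans (ℕP.≤-reflexive (sym (χ-yes _ (s∈S , ·-identityˡ s))))
                          (term≤∑ (λ s′ → hits (+ 1) s′ s) (∈-allFin s))

±1∈M∧odd⇒¬Splits : ∀ {p} {{_ : NonZero p}} {M} → Prime p → Unique M → - + 1 ∈ M → + 1 ∈ M →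
                    length M ℕ.% 2 ≡ 1 → ¬ Splits M p
±1∈M∧odd⇒¬Splits {p} {M = M} pr M-unique -1∈M 1∈M |M|-odd split =
  let s , s∈S = S-inhabited pr
      N[s]<P[s] = subst (_< P s) (sym (#reps-id-nonzero (∈S⇒nonzero 1∈M s∈S)))
                        (#reps-square-≥2 1∈M -1∈M s∈S)
  in  ℕP.<-irrefl (trans (∑-#reps id) (sym (∑-#reps square)))
                  (∑-mono-< N≤P (∈-allFin s) N[s]<P[s])
  where
  open Splitting M-unique split
  N P : Fin p → ℕ
  N = #reps id
  P = #reps square
  odd⇒positive : ∀ {n} → n ℕ.% 2 ≡ 1 → 1 ≤ n
  odd⇒positive {zero}  ()
  odd⇒positive {suc _} _ = s≤s z≤n
  N≤P : ∀ g → N g ≤ P g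
  N≤P g with toℕ g ℕP.≟ 0
  ... | yes g≡0 = subst (_≤ P g) (sym (#reps-id-zero g≡0)) z≤n
  ... | no g≢0  = subst (_≤ P g) (sym (#reps-id-nonzero g≢0))
                        (odd⇒positive (#reps-square-odd pr |M|-odd g≢0))

length-intervalStar : ∀ k₁ k₂ → length (intervalStar k₁ k₂) ≡ k₁ ℕ.+ k₂
length-intervalStar k₁ k₂ = trans (length-++ (map -[1+_] (upTo k₁)))
  (cong₂ ℕ._+_ (trans (length-map -[1+_] (upTo k₁)) (length-upTo k₁))
               (trans (length-map (λ i → + suc i) (upTo k₂)) (length-upTo k₂)))

intervalStar-unique : ∀ k₁ k₂ → Unique (intervalStar k₁ k₂)
intervalStar-unique k₁ k₂ =
  Unique.++⁺ (Unique.map⁺ -[1+-injective (Unique.upTo⁺ k₁))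
             (Unique.map⁺ +[1+-injective (Unique.upTo⁺ k₂))
             disjoint
  where
  -[1+-injective : ∀ {x y} → -[1+ x ] ≡ -[1+ y ] → x ≡ y
  -[1+-injective refl = refl
  +[1+-injective : ∀ {x y} → + suc x ≡ + suc y → x ≡ y
  +[1+-injective refl = refl
  disjoint : ∀ {v} → ¬ (v ∈ map -[1+_] (upTo k₁) × v ∈ map (λ i → + suc i) (upTo k₂))
  disjoint (v∈neg , v∈pos) with ∈-map⁻ -[1+_] v∈neg | ∈-map⁻ (λ i → + suc i) v∈pos
  ... | _ , _ , refl | _ , _ , ()

-1∈intervalStar : ∀ {k₁} k₂ → 1 ≤ k₁ → - + 1 ∈ intervalStar k₁ k₂
-1∈intervalStar {suc _} k₂ _ = ∈-++⁺ˡ {ys = map (λ i → + suc i) (upTo k₂)} (here refl)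

1∈intervalStar : ∀ {k₁ k₂} → 1 ≤ k₁ → k₁ ≤ k₂ → + 1 ∈ intervalStar k₁ k₂
1∈intervalStar {suc k₁} {suc _} _ _ = ∈-++⁺ʳ (map -[1+_] (upTo (suc k₁))) (here refl)

-- The hypothesis that M omits 0 is not needed.
theorem3p5 : ((M : List ℤ) → Unique M → All (λ m → m ≢ + 0) M →
    (- + 1) ∈ M → + 1 ∈ M → length M ℕ.% 2 ≡ 1 →
    (p : ℕ) (pr : Prime p) → ¬ Splits M p {{prime⇒nonZero pr}})
    ×
    ((k₁ k₂ : ℕ) → 1 ≤ k₁ → k₁ ≤ k₂ → (k₁ ℕ.+ k₂) ℕ.% 2 ≡ 1 →
    (p : ℕ) (pr : Prime p) → ¬ Splits (intervalStar k₁ k₂) p {{prime⇒nonZero pr}})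
theorem3p5 =
  (λ M M-unique _ -1∈M 1∈M |M|-odd p pr →
    ±1∈M∧odd⇒¬Splits {{prime⇒nonZero pr}} pr M-unique -1∈M 1∈M |M|-odd) ,
  (λ k₁ k₂ 1≤k₁ k₁≤k₂ k₁+k₂-odd p pr →
    ±1∈M∧odd⇒¬Splits {{prime⇒nonZero pr}} pr (intervalStar-unique k₁ k₂)
      (-1∈intervalStar k₂ 1≤k₁) (1∈intervalStar 1≤k₁ k₁≤k₂)
      (trans (cong (ℕ._% 2) (length-intervalStar k₁ k₂)) k₁+k₂-odd))
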